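{- Let $\Gamma$ be a binary group and $S^+,S^-\subseteq\Gamma$, and let $\hat G=(\Gamma,S^+,S^-)$ be the corresponding signed Cayley graph. If the underlying graph of $\hat G$ is bipartite and $\hat G$ has unbalanced girth $2k$, then $\hat G$ contains the signed projective cube $SPC(2k-1)$ as an induced subgraph.
   Context: A binary group is an abelian group in which every element $x$ satisfies $x+x=0$. A signed graph is a graph with a sign $+$ or $-$ on each edge; switching at a vertex set $X$ multiplies the signs of the edges with exactly one end in $X$ by $-1$, and signed graphs are considered up to switching (so containment of $SPC(2k-1)$ means containment of a signed graph switching equivalent to it). For an abelian group $\Gamma$ and subsets $S^+,S^-$ with $-S^+=S^+$, $-S^-=S^-$, the signed Cayley graph $(\Gamma,S^+,S^-)$ has vertex set $\Gamma$, a positive edge $xy$ iff $x-y\in S^+$, and a negative edge $xy$ iff $x-y\in S^-$. The sign of a cycle is the product of the signs of its edges; the unbalanced girth is the length of a shortest negative cycle. The signed projective cube $SPC(m)$ is the signed Cayley graph $(\mathbb{Z}_2^m,\{e_1,\dots,e_m\},\{J\})$, where $e_1,\dots,e_m$ is the standard basis and $J$ the all-ones vector. An induced subgraph is one induced on a vertex subset, keeping all edges (with their signs) between those vertices. -}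

module Defs where

open import Level using (Level; _⊔_; 0ℓ)
open import Data.Nat using (ℕ; zero; suc; _≤_; _<_)
open import Data.Fin using (Fin; zero; suc)
open import Data.Bool using (Bool; true; false; _xor_)
open import Data.Vec using (Vec; zipWith; replicate; updateAt)
open import Data.Product using (Σ; ∃; _×_)
open import Relation.Unary using (Pred)
open import Relation.Binary.PropositionalEquality using (_≡_; _≢_)
open import Relation.Nullary using (¬_)
open import Function.Bundles using (_⇔_)
open import Algebra.Bundles using (AbelianGroup)

data Sign : Set where
  pos neg : Sign

_·_ : Sign → Sign → Sign
pos · s   = s
neg · pos = neg
neg · neg = pos

prod : ∀ {n} → (Fin n → Sign) → Sign
prod {zero}  f = pos
prod {suc n} f = f zero · prod (λ i → f (suc i))

-- cyclic successor on Fin n  (i ↦ i+1 mod n)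
cyc : ∀ {n} → Fin n → Fin n
cyc {suc zero}    zero    = zero
cyc {suc (suc n)} zero    = suc zero
cyc {suc (suc n)} (suc i) with cyc {suc n} i
... | zero  = zero
... | suc j = suc (suc j)

IsBinary : ∀ {c ℓ} → AbelianGroup c ℓ → Set (c ⊔ ℓ)
IsBinary G = ∀ x → (x ∙ x) ≈ ε
  where open AbelianGroup G

-- Between x and y there is an
-- edge of sign pos iff x - y ∈ S⁺ and an edge of sign neg iff x - y ∈ S⁻
-- (so it is a signed multigraph with at most one edge of each sign
-- between two vertices; a loop at x iff 0 ∈ S⁺ ∪ S⁻).

module SignedCayley {c ℓ p} (G : AbelianGroup c ℓ)
                    (S⁺ S⁻ : Pred (AbelianGroup.Carrier G) p) where
  open AbelianGroup G

  Conn : Sign → Pred Carrier p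
  Conn pos = S⁺
  Conn neg = S⁻

  Edge : Carrier → Carrier → Sign → Set p
  Edge x y s = Conn s (x ∙ (y ⁻¹))

  Bipartite : Set (c ⊔ ℓ ⊔ p)
  Bipartite = Σ (Carrier → Bool) λ col →
                (∀ x y → x ≈ y → col x ≡ col y) ×
                (∀ x y s → Edge x y s → col x ≢ col y)

  -- A cycle of length n ≥ 1: distinct vertices v₀,…,v_{n-1}, and edges
  -- eᵢ = vᵢ v_{i+1 mod n} of sign σᵢ, the edges being pairwise distinct.
  record Cycle (n : ℕ) : Set (c ⊔ ℓ ⊔ p) where
    field
      nonempty : 1 ≤ n
      vert     : Fin n → Carrier
      sgn      : Fin n → Sign
      distinct : ∀ i j → vert i ≈ vert j → i ≡ j
      edge     : ∀ i → Edge (vert i) (vert (cyc i)) (sgn i)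
      edgesDistinct : ∀ i j → i ≢ j → vert i ≈ vert (cyc j) →
                      vert (cyc i) ≈ vert j → sgn i ≢ sgn j

  sign : ∀ {n} → Cycle n → Sign
  sign C = prod (Cycle.sgn C)

  Negative : ∀ {n} → Cycle n → Set
  Negative C = sign C ≡ neg

  UnbalancedGirth : ℕ → Set (c ⊔ ℓ ⊔ p)
  UnbalancedGirth g = Σ (Cycle g) Negative ×
                      (∀ n → n < g → (C : Cycle n) → ¬ Negative C)

-- The signed projective cube SPC(m) = (ℤ₂^m, {e₁,…,e_m}, {J}).
-- Vertices: Vec Bool m (ℤ₂^m, addition = pointwise xor, u - v = u xor v).

basis : ∀ {m} → Fin m → Vec Bool m
basis i = updateAt (replicate _ false) i (λ _ → true)

allOnes : ∀ {m} → Vec Bool m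
allOnes = replicate _ true

SPCEdge : ∀ m → Vec Bool m → Vec Bool m → Sign → Set
SPCEdge m u v pos = ∃ λ (i : Fin m) → zipWith _xor_ u v ≡ basis i
SPCEdge m u v neg = zipWith _xor_ u v ≡ allOnes

-- Ĝ contains a signed graph switching equivalent to SPC(m) as an induced
-- subgraph: an injective vertex map φ and a switching τ (τ u = neg iff
-- u ∈ X) such that, for every pair u v and sign s, φu φv is an edge of
-- sign s in Ĝ iff uv is an edge of sign s in SPC(m) switched at X.

module _ {c ℓ p} (G : AbelianGroup c ℓ)
         (S⁺ S⁻ : Pred (AbelianGroup.Carrier G) p) where
  open AbelianGroup G
  open SignedCayley G S⁺ S⁻

  ContainsInducedSPC : ℕ → Set (c ⊔ ℓ ⊔ p)
  ContainsInducedSPC m =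
    Σ (Vec Bool m → Carrier) λ φ →
      (∀ u v → φ u ≈ φ v → u ≡ v) ×
      Σ (Vec Bool m → Sign) λ τ →
        ∀ u v s → Edge (φ u) (φ v) s ⇔ SPCEdge m u v ((τ u · τ v) · s)

-- Let C be a shortest negative cycle, of length m + 1, and read its edges as
-- differences d₀, d₁, …, d_m ∈ Γ with signs σ₀, …, σ_m, so that d₀ + ⋯ + d_m = 0 as Γ
-- is binary.  Send w ∈ ℤ₂^m to φ(w) = ∑_{wᵢ = 1} dᵢ and switch it by τ(w) = ∏_{wᵢ = 1} σᵢ.
-- A negative closed walk contains a negative cycle, so it has length at least m + 1;
-- hence C is geodesic: a walk between two vertices of C with the sign of one of the two
-- arcs joining them is at least as long as that arc.  An edge φ(u) φ(v) is such a walk of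
-- length one for the arcs cut out by w = u + v, so either w is a basis vector (a positive
-- edge after switching) or w is the all-ones vector (the closing edge d₀, negative).  The
-- empty walk shows in the same way that φ is injective.

module Submission where

open import Defs
open import Level using (_⊔_)
open import Algebra.Bundles using (AbelianGroup)
open import Data.Nat using (ℕ; zero; suc; _+_; _*_; _∸_; _≤_; _<_; s≤s; z≤n)
open import Data.Nat.Properties
  using (suc-injective; m≢1+n+m; +-suc; +-comm; ≤-refl; ≤-trans; <⇒≤; ≤-<-trans; <-cmp; ≮⇒≥;
         ≤-antisym; n≤0⇒n≡0; ≤-pred; +-cancelʳ-≤; m<m+n; m<n+m; m≤n+m; +-monoʳ-<;
         m≤n⇒m⊓n≡m; m<n⇒0<n∸m)
open import Data.Nat.Induction using (<-wellFounded)
open import Induction.WellFounded using (Acc; acc)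
open import Data.Fin using (Fin; toℕ; inject₁; fromℕ) renaming (zero to fzero; suc to fsuc)
open import Data.Fin.Properties using (toℕ-injective; toℕ<n)
open import Data.Bool using (Bool; true; false; _xor_)
open import Data.Vec using (Vec; []; _∷_; zipWith; replicate; tail)
open import Data.List using (List; []; _∷_; _++_; _∷ʳ_; length; take; drop; lookup)
open import Data.List.Properties
  using (length-++; ++-assoc; take-suc; take-all; take-take; take++drop≡id; length-take; length-drop)
open import Data.List.Relation.Unary.All using (All; []; _∷_)
import Data.List.Relation.Unary.All as All
open import Data.List.Relation.Unary.All.Properties using (++⁺; ++⁻)
open import Data.List.Membership.Propositional.Properties using (∈-lookup)
open import Data.Product using (Σ; ∃; _×_; _,_; proj₁; proj₂)
open import Data.Sum using (_⊎_; inj₁; inj₂)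
open import Data.Empty using (⊥-elim)
open import Function using (_∘_)
open import Function.Bundles using (mk⇔)
open import Relation.Unary using (Pred)
open import Relation.Binary.Definitions using (_Respects_; tri<; tri≈; tri>)
open import Relation.Nullary using (¬_; yes; no; contradiction)
open import Relation.Nullary.Decidable using (¬¬-excluded-middle)
open import Relation.Binary.PropositionalEquality as ≡
  using (_≡_; _≢_; refl; cong; cong₂; subst; subst₂)

·-identityʳ : ∀ a → a · pos ≡ a
·-identityʳ pos = refl
·-identityʳ neg = refl

·-comm : ∀ a b → a · b ≡ b · a
·-comm pos pos = refl
·-comm pos neg = refl
·-comm neg pos = refl
·-comm neg neg = refl

·-assoc : ∀ a b c → (a · b) · c ≡ a · (b · c)
·-assoc pos b   c = refl
·-assoc neg pos c = refl
·-assoc neg neg pos = refl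
·-assoc neg neg neg = refl

s·s≡pos : ∀ s → s · s ≡ pos
s·s≡pos pos = refl
s·s≡pos neg = refl

·-cancelˡ-≡ : ∀ a {b c} → a · b ≡ a · c → b ≡ c
·-cancelˡ-≡ pos eq = eq
·-cancelˡ-≡ neg {pos} {pos} _ = refl
·-cancelˡ-≡ neg {neg} {neg} _ = refl

x·yz≡y·xz : ∀ a b c → a · (b · c) ≡ b · (a · c)
x·yz≡y·xz pos b   c = refl
x·yz≡y·xz neg pos c = refl
x·yz≡y·xz neg neg c = refl

xy·xz≡yz : ∀ a b c → (a · b) · (a · c) ≡ b · c
xy·xz≡yz pos b   c   = refl
xy·xz≡yz neg pos pos = refl
xy·xz≡yz neg pos neg = refl
xy·xz≡yz neg neg c   = refl

·≡neg⇒≢ : ∀ {a b} → a · b ≡ neg → a ≢ b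
·≡neg⇒≢ {pos} () refl
·≡neg⇒≢ {neg} () refl

·≡pos⇒≡ : ∀ a {b} → a · b ≡ pos → a ≡ b
·≡pos⇒≡ pos refl = refl
·≡pos⇒≡ neg {neg} _ = refl

either-sign : ∀ {a b} → a · b ≡ neg → ∀ s → s ≡ a ⊎ s ≡ b
either-sign {pos} {neg} _ pos = inj₁ refl
either-sign {pos} {neg} _ neg = inj₂ refl
either-sign {neg} {pos} _ pos = inj₂ refl
either-sign {neg} {pos} _ neg = inj₁ refl

toℕ-cyc : ∀ {n} (i : Fin n) →
          toℕ (cyc i) ≡ suc (toℕ i) ⊎ (toℕ (cyc i) ≡ 0 × suc (toℕ i) ≡ n)
toℕ-cyc {suc zero}    fzero    = inj₂ (refl , refl)
toℕ-cyc {suc (suc n)} fzero    = inj₁ refl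
toℕ-cyc {suc (suc n)} (fsuc i) with cyc {suc n} i | toℕ-cyc {suc n} i
... | fzero  | inj₂ (_ , last) = inj₂ (refl , cong suc last)
... | fsuc j | inj₁ next       = inj₁ (cong suc next)

cyc-inject₁ : ∀ {n} (i : Fin n) → cyc (inject₁ i) ≡ fsuc i
cyc-inject₁ {suc n} fzero = refl
cyc-inject₁ {suc n} (fsuc i) with cyc (inject₁ i) | cyc-inject₁ i
... | _ | refl = refl

cyc-fromℕ : ∀ n → cyc (fromℕ n) ≡ fzero
cyc-fromℕ zero = refl
cyc-fromℕ (suc n) with cyc (fromℕ n) | cyc-fromℕ n
... | _ | refl = refl

cyc∘cyc≢id : ∀ {n} (i : Fin (3 + n)) → cyc (cyc i) ≢ i
cyc∘cyc≢id i eq with toℕ-cyc i | toℕ-cyc (cyc i) | cong toℕ eq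
... | inj₁ once | inj₁ twice | back =
  m≢1+n+m (toℕ i) (≡.trans (≡.sym back) (≡.trans twice (cong suc once)))
... | inj₁ once | inj₂ (wrap , last) | back =
  contradiction (≡.trans (cong (suc ∘ suc) (≡.trans (≡.sym wrap) back))
                         (≡.trans (cong suc (≡.sym once)) last)) λ ()
... | inj₂ (wrap , last) | inj₁ once | back =
  contradiction (≡.trans (cong suc (≡.trans (≡.sym (≡.trans once (cong suc wrap))) back)) last) λ ()
... | inj₂ (wrap , _) | inj₂ (_ , last) | _ =
  contradiction (≡.trans (cong suc (≡.sym wrap)) last) λ ()

infixl 6 _⊕_
_⊕_ : ∀ {m} → Vec Bool m → Vec Bool m → Vec Bool m
_⊕_ = zipWith _xor_

module _ {a} {A : Set a} where

  select : ∀ {m} → Vec Bool m → (Fin m → A) → List A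
  select []          f = []
  select (true  ∷ w) f = f fzero ∷ select w (f ∘ fsuc)
  select (false ∷ w) f = select w (f ∘ fsuc)

  reject : ∀ {m} → Vec Bool m → (Fin m → A) → List A
  reject []          f = []
  reject (true  ∷ w) f = reject w (f ∘ fsuc)
  reject (false ∷ w) f = f fzero ∷ reject w (f ∘ fsuc)

  length-select+reject : ∀ {m} (w : Vec Bool m) f →
                         length (select w f) + length (reject w f) ≡ m
  length-select+reject []          f = refl
  length-select+reject (true  ∷ w) f = cong suc (length-select+reject w (f ∘ fsuc))
  length-select+reject (false ∷ w) f =
    ≡.trans (+-suc _ _) (cong suc (length-select+reject w (f ∘ fsuc)))

  module _ {p} {P : A → Set p} where

    select⁺ : ∀ {m} (w : Vec Bool m) {f} → (∀ i → P (f i)) → All P (select w f)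
    select⁺ []          Pf = []
    select⁺ (true  ∷ w) Pf = Pf fzero ∷ select⁺ w (Pf ∘ fsuc)
    select⁺ (false ∷ w) Pf = select⁺ w (Pf ∘ fsuc)

    reject⁺ : ∀ {m} (w : Vec Bool m) {f} → (∀ i → P (f i)) → All P (reject w f)
    reject⁺ []          Pf = []
    reject⁺ (true  ∷ w) Pf = reject⁺ w (Pf ∘ fsuc)
    reject⁺ (false ∷ w) Pf = Pf fzero ∷ reject⁺ w (Pf ∘ fsuc)

  select-replicate-false : ∀ m (f : Fin m → A) → select (replicate m false) f ≡ []
  select-replicate-false zero    f = refl
  select-replicate-false (suc m) f = select-replicate-false m (f ∘ fsuc)

  select-basis : ∀ {m} (i : Fin m) f → select (basis i) f ≡ f i ∷ []
  select-basis {suc m} fzero    f = cong (f fzero ∷_) (select-replicate-false m (f ∘ fsuc))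
  select-basis {suc m} (fsuc i) f = select-basis i (f ∘ fsuc)

  reject-allOnes : ∀ m (f : Fin m → A) → reject (allOnes {m}) f ≡ []
  reject-allOnes zero    f = refl
  reject-allOnes (suc m) f = reject-allOnes m (f ∘ fsuc)

  select-empty : ∀ {m} (w : Vec Bool m) f → length (select w f) ≡ 0 → w ≡ replicate m false
  select-empty []          f _  = refl
  select-empty (false ∷ w) f eq = cong (false ∷_) (select-empty w (f ∘ fsuc) eq)

  select-singleton : ∀ {m} (w : Vec Bool m) f → length (select w f) ≡ 1 → ∃ λ i → w ≡ basis i
  select-singleton (true ∷ w) f eq =
    fzero , cong (true ∷_) (select-empty w (f ∘ fsuc) (suc-injective eq))
  select-singleton (false ∷ w) f eq with select-singleton w (f ∘ fsuc) eq
  ... | i , w≡eᵢ = fsuc i , cong (false ∷_) w≡eᵢ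

  reject-empty : ∀ {m} (w : Vec Bool m) f → length (reject w f) ≡ 0 → w ≡ allOnes
  reject-empty []         f _  = refl
  reject-empty (true ∷ w) f eq = cong (true ∷_) (reject-empty w (f ∘ fsuc) eq)

  length-infix< : ∀ (xs ys zs : List A) → 0 < length zs → length ys < length (xs ++ ys ++ zs)
  length-infix< xs ys zs 0<|zs| rewrite length-++ xs {ys ++ zs} | length-++ ys {zs} =
    ≤-trans (m<m+n (length ys) 0<|zs|) (m≤n+m _ (length xs))

  length-excise< : ∀ (xs ys zs : List A) → 0 < length ys →
                   length (xs ++ zs) < length (xs ++ ys ++ zs)
  length-excise< xs ys zs 0<|ys|
    rewrite length-++ xs {zs} | length-++ xs {ys ++ zs} | length-++ ys {zs} =
    +-monoʳ-< (length xs) (m<n+m (length zs) 0<|ys|)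

⊕≡0⇒≡ : ∀ {m} (u v : Vec Bool m) → u ⊕ v ≡ replicate m false → u ≡ v
⊕≡0⇒≡ []          []          _  = refl
⊕≡0⇒≡ (true  ∷ u) (true  ∷ v) eq = cong (true ∷_)  (⊕≡0⇒≡ u v (cong tail eq))
⊕≡0⇒≡ (false ∷ u) (false ∷ v) eq = cong (false ∷_) (⊕≡0⇒≡ u v (cong tail eq))

module SignedCayleyWalks {c ℓ p} (Γ : AbelianGroup c ℓ) (binary : IsBinary Γ)
         (S⁺ S⁻ : Pred (AbelianGroup.Carrier Γ) p)
         (S⁺-resp : S⁺ Respects AbelianGroup._≈_ Γ) (S⁻-resp : S⁻ Respects AbelianGroup._≈_ Γ) where

  open AbelianGroup Γ renaming (refl to ≈-refl)
  open SignedCayley Γ S⁺ S⁻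
  open import Algebra.Properties.Group group using (inverseˡ-unique)
  open import Algebra.Properties.CommutativeSemigroup commutativeSemigroup using (interchange; x∙yz≈y∙xz)
  open import Algebra.Properties.CommutativeMonoid.Sum commutativeMonoid
    using (sum; sum-init-last; ∑-distrib-+; sum-cong-≋; sum-cong-≗)
  open import Relation.Binary.Reasoning.Setoid setoid

  x⁻¹≈x : ∀ x → x ⁻¹ ≈ x
  x⁻¹≈x x = sym (inverseˡ-unique x x (binary x))

  ∙≈ε⇒≈ : ∀ {x y} → x ∙ y ≈ ε → x ≈ y
  ∙≈ε⇒≈ {x} {y} xy≈ε = trans (inverseˡ-unique x y xy≈ε) (x⁻¹≈x y)

  ≈⇒∙≈ε : ∀ {x y} → x ≈ y → x ∙ y ≈ ε
  ≈⇒∙≈ε {x} {y} x≈y = trans (∙-congʳ x≈y) (binary y)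

  x∙[x∙y]≈y : ∀ x y → x ∙ (x ∙ y) ≈ y
  x∙[x∙y]≈y x y = begin
    x ∙ (x ∙ y)  ≈⟨ assoc x x y ⟨
    (x ∙ x) ∙ y  ≈⟨ ∙-congʳ (binary x) ⟩
    ε ∙ y        ≈⟨ identityˡ y ⟩
    y            ∎

  xy∙xz≈yz : ∀ x y z → (x ∙ y) ∙ (x ∙ z) ≈ y ∙ z
  xy∙xz≈yz x y z = begin
    (x ∙ y) ∙ (x ∙ z)  ≈⟨ interchange x y x z ⟩
    (x ∙ x) ∙ (y ∙ z)  ≈⟨ ∙-congʳ (binary x) ⟩
    ε ∙ (y ∙ z)        ≈⟨ identityˡ (y ∙ z) ⟩
    y ∙ z              ∎

  Conn-resp : ∀ s → Conn s Respects _≈_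
  Conn-resp pos = S⁺-resp
  Conn-resp neg = S⁻-resp

  Step : Set c
  Step = Carrier × Sign

  Admissible : Step → Set p
  Admissible (g , s) = Conn s g

  ∑ : List Step → Carrier
  ∑ []            = ε
  ∑ ((g , _) ∷ W) = g ∙ ∑ W

  ∏ : List Step → Sign
  ∏ []            = pos
  ∏ ((_ , s) ∷ W) = s · ∏ W

  ∑-++ : ∀ V W → ∑ (V ++ W) ≈ ∑ V ∙ ∑ W
  ∑-++ []            W = sym (identityˡ (∑ W))
  ∑-++ ((g , _) ∷ V) W = trans (∙-congˡ (∑-++ V W)) (sym (assoc g (∑ V) (∑ W)))

  ∏-++ : ∀ V W → ∏ (V ++ W) ≡ ∏ V · ∏ W
  ∏-++ []            W = refl
  ∏-++ ((_ , s) ∷ V) W = ≡.trans (cong (s ·_) (∏-++ V W)) (≡.sym (·-assoc s (∏ V) (∏ W)))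

  record NegativeClosedWalk (W : List Step) : Set (c ⊔ ℓ ⊔ p) where
    field
      admissible : All Admissible W
      closed     : ∑ W ≈ ε
      negative   : ∏ W ≡ neg

  vertex : List Step → ℕ → Carrier
  vertex W a = ∑ (take a W)

  vertex-suc : ∀ W (i : Fin (length W)) →
               vertex W (suc (toℕ i)) ≈ vertex W (toℕ i) ∙ proj₁ (lookup W i)
  vertex-suc W i = begin
    ∑ (take (suc (toℕ i)) W)                 ≡⟨ cong ∑ (take-suc W i) ⟩
    ∑ (take (toℕ i) W ∷ʳ lookup W i)         ≈⟨ ∑-++ (take (toℕ i) W) _ ⟩
    vertex W (toℕ i) ∙ (proj₁ (lookup W i) ∙ ε) ≈⟨ ∙-congˡ (identityʳ _) ⟩
    vertex W (toℕ i) ∙ proj₁ (lookup W i)    ∎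

  vertex-cyc : ∀ W → ∑ W ≈ ε → (i : Fin (length W)) →
               vertex W (toℕ (cyc i)) ≈ vertex W (toℕ i) ∙ proj₁ (lookup W i)
  vertex-cyc W closed i with toℕ-cyc i
  ... | inj₁ next rewrite next = vertex-suc W i
  ... | inj₂ (wrap , last) rewrite wrap = begin
    ε                                     ≈⟨ closed ⟨
    ∑ W                                   ≡⟨ cong ∑ (take-all (length W) W ≤-refl) ⟨
    vertex W (length W)                   ≡⟨ cong (vertex W) last ⟨
    vertex W (suc (toℕ i))                ≈⟨ vertex-suc W i ⟩
    vertex W (toℕ i) ∙ proj₁ (lookup W i) ∎

  ∏≡neg⇒nonempty : ∀ W → ∏ W ≡ neg → 1 ≤ length W
  ∏≡neg⇒nonempty (_ ∷ _) _ = s≤s z≤n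

  prod-lookup : ∀ W → prod (λ i → proj₂ (lookup W i)) ≡ ∏ W
  prod-lookup []            = refl
  prod-lookup ((_ , s) ∷ W) = cong (s ·_) (prod-lookup W)

  -- Only a 2-cycle can have two distinct edges joining the same pair of vertices;
  -- its two edges then have different signs as the cycle is negative.
  injective⇒edgesDistinct : ∀ {n} (v : Fin n → Carrier) (σ : Fin n → Sign) → prod σ ≡ neg →
    (∀ i j → v i ≈ v j → i ≡ j) →
    ∀ i j → i ≢ j → v i ≈ v (cyc j) → v (cyc i) ≈ v j → σ i ≢ σ j
  injective⇒edgesDistinct {1} v σ _ _ fzero fzero i≢j _ _ = ⊥-elim (i≢j refl)
  injective⇒edgesDistinct {2} v σ _ _ fzero fzero i≢j _ _ = ⊥-elim (i≢j refl)
  injective⇒edgesDistinct {2} v σ _ _ (fsuc fzero) (fsuc fzero) i≢j _ _ = ⊥-elim (i≢j refl)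
  injective⇒edgesDistinct {2} v σ σ≡neg _ fzero (fsuc fzero) _ _ _ =
    ·≡neg⇒≢ (≡.trans (cong (σ fzero ·_) (≡.sym (·-identityʳ _))) σ≡neg)
  injective⇒edgesDistinct {2} v σ σ≡neg _ (fsuc fzero) fzero _ _ _ =
    ·≡neg⇒≢ (≡.trans (cong (σ fzero ·_) (≡.sym (·-identityʳ _))) σ≡neg) ∘ ≡.sym
  injective⇒edgesDistinct {suc (suc (suc n))} v σ _ inj i j _ vi≈vcj vci≈vj =
    ⊥-elim (cyc∘cyc≢id j (≡.trans (cong cyc (≡.sym (inj _ _ vi≈vcj))) (inj _ _ vci≈vj)))

  HasRepeatedVertex : List Step → Set ℓ
  HasRepeatedVertex W = ∃ λ a → ∃ λ b → a < b × b < length W × vertex W a ≈ vertex W b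

  cycleOfWalk : ∀ {W} → NegativeClosedWalk W → ¬ HasRepeatedVertex W →
                Σ (Cycle (length W)) Negative
  cycleOfWalk {W} ncw noRepeat = C , ≡.trans (prod-lookup W) negative
    where
    open NegativeClosedWalk ncw
    vert : Fin (length W) → Carrier
    vert i = vertex W (toℕ i)
    σ : Fin (length W) → Sign
    σ i = proj₂ (lookup W i)
    distinct : ∀ i j → vert i ≈ vert j → i ≡ j
    distinct i j vi≈vj with <-cmp (toℕ i) (toℕ j)
    ... | tri< i<j _ _ = ⊥-elim (noRepeat (_ , _ , i<j , toℕ<n j , vi≈vj))
    ... | tri≈ _ i≡j _ = toℕ-injective i≡j
    ... | tri> _ _ j<i = ⊥-elim (noRepeat (_ , _ , j<i , toℕ<n i , sym vi≈vj))
    edge : ∀ i → Edge (vert i) (vert (cyc i)) (σ i)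
    edge i = Conn-resp (σ i) step≈ (All.lookup admissible (∈-lookup i))
      where
      step≈ : proj₁ (lookup W i) ≈ vert i ∙ vert (cyc i) ⁻¹
      step≈ = begin
        proj₁ (lookup W i)                            ≈⟨ x∙[x∙y]≈y (vert i) _ ⟨
        vert i ∙ (vert i ∙ proj₁ (lookup W i))        ≈⟨ ∙-congˡ (vertex-cyc W closed i) ⟨
        vert i ∙ vert (cyc i)                         ≈⟨ ∙-congˡ (x⁻¹≈x _) ⟨
        vert i ∙ vert (cyc i) ⁻¹                      ∎
    C : Cycle (length W)
    C = record
      { nonempty      = ∏≡neg⇒nonempty W negative
      ; vert          = vert
      ; sgn           = σ
      ; distinct      = distinct
      ; edge          = edge
      ; edgesDistinct = injective⇒edgesDistinct vert σ (≡.trans (prod-lookup W) negative) distinct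
      }

  excise : ∀ Q M S → NegativeClosedWalk (Q ++ M ++ S) → ∑ M ≈ ε → 0 < length M → 0 < length S →
           ∃ λ W → length W < length (Q ++ M ++ S) × NegativeClosedWalk W
  excise Q M S ncw ∑M≈ε 0<|M| 0<|S| with ∏ M in ∏M≡
  ... | neg = M , length-infix< Q M S 0<|S| , record
    { admissible = proj₁ (++⁻ M (proj₂ (++⁻ Q admissible)))
    ; closed     = ∑M≈ε
    ; negative   = ∏M≡
    }
    where open NegativeClosedWalk ncw
  ... | pos = Q ++ S , length-excise< Q M S 0<|M| , record
    { admissible = ++⁺ (proj₁ admQ/MS) (proj₂ (++⁻ M (proj₂ admQ/MS)))
    ; closed     = closed′
    ; negative   = negative′
    }
    where
    open NegativeClosedWalk ncw
    admQ/MS = ++⁻ Q admissible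
    negative′ : ∏ (Q ++ S) ≡ neg
    negative′ =
      ≡.trans (∏-++ Q S)
        (≡.trans (cong (λ s → ∏ Q · (s · ∏ S)) (≡.sym ∏M≡))
          (≡.trans (cong (∏ Q ·_) (≡.sym (∏-++ M S)))
            (≡.trans (≡.sym (∏-++ Q (M ++ S))) negative)))
    closed′ : ∑ (Q ++ S) ≈ ε
    closed′ = begin
      ∑ (Q ++ S)            ≈⟨ ∑-++ Q S ⟩
      ∑ Q ∙ ∑ S             ≈⟨ ∙-congˡ (identityˡ (∑ S)) ⟨
      ∑ Q ∙ (ε ∙ ∑ S)       ≈⟨ ∙-congˡ (∙-congʳ ∑M≈ε) ⟨
      ∑ Q ∙ (∑ M ∙ ∑ S)     ≈⟨ ∙-congˡ (∑-++ M S) ⟨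
      ∑ Q ∙ ∑ (M ++ S)      ≈⟨ ∑-++ Q (M ++ S) ⟨
      ∑ (Q ++ M ++ S)       ≈⟨ closed ⟩
      ε                     ∎

  shortcut : ∀ {W} → NegativeClosedWalk W → HasRepeatedVertex W →
             ∃ λ W′ → length W′ < length W × NegativeClosedWalk W′
  shortcut {W} ncw (a , b , a<b , b<|W| , va≈vb) =
    subst (λ V → ∃ λ W′ → length W′ < length V × NegativeClosedWalk W′) QMS≡W
      (excise Q M S (subst NegativeClosedWalk (≡.sym QMS≡W) ncw) ∑M≈ε 0<|M| 0<|S|)
    where
    Q M S : List Step
    Q = take a W
    M = drop a (take b W)
    S = drop b W
    QM≡ : Q ++ M ≡ take b W
    QM≡ = ≡.trans (cong (λ n → take n W ++ M) (≡.sym (m≤n⇒m⊓n≡m (<⇒≤ a<b))))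
            (≡.trans (cong (_++ M) (≡.sym (take-take a b W))) (take++drop≡id a (take b W)))
    QMS≡W : Q ++ M ++ S ≡ W
    QMS≡W = ≡.trans (≡.sym (++-assoc Q M S)) (≡.trans (cong (_++ S) QM≡) (take++drop≡id b W))
    ∑M≈ε : ∑ M ≈ ε
    ∑M≈ε = begin
      ∑ M                      ≈⟨ x∙[x∙y]≈y (∑ Q) (∑ M) ⟨
      ∑ Q ∙ (∑ Q ∙ ∑ M)        ≈⟨ ∙-congˡ (∑-++ Q M) ⟨
      ∑ Q ∙ ∑ (Q ++ M)         ≡⟨ cong (λ V → ∑ Q ∙ ∑ V) QM≡ ⟩
      vertex W a ∙ vertex W b  ≈⟨ ≈⇒∙≈ε va≈vb ⟩
      ε                        ∎
    0<|M| : 0 < length M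
    0<|M| = subst (0 <_)
      (≡.sym (≡.trans (length-drop a (take b W))
        (cong (_∸ a) (≡.trans (length-take b W) (m≤n⇒m⊓n≡m (<⇒≤ b<|W|))))))
      (m<n⇒0<n∸m a<b)
    0<|S| : 0 < length S
    0<|S| = subst (0 <_) (≡.sym (length-drop b W)) (m<n⇒0<n∸m b<|W|)

  NegativeCycleOfLengthAtMost : ℕ → Set (c ⊔ ℓ ⊔ p)
  NegativeCycleOfLengthAtMost n = ∃ λ L → L ≤ n × Σ (Cycle L) Negative

  -- Equality in Γ need not be decidable, hence the double negation.
  negativeClosedWalk⇒negativeCycle : ∀ {W} → NegativeClosedWalk W →
                                     ¬ ¬ NegativeCycleOfLengthAtMost (length W)
  negativeClosedWalk⇒negativeCycle {W} = go W (<-wellFounded (length W))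
    where
    go : ∀ W → Acc _<_ (length W) → NegativeClosedWalk W → ¬ ¬ NegativeCycleOfLengthAtMost (length W)
    go W (acc shorter) ncw noCycle = ¬¬-excluded-middle λ where
      (yes repeated) →
        let W′ , |W′|<|W| , ncw′ = shortcut ncw repeated in
        go W′ (shorter |W′|<|W|) ncw′ λ (L , L≤|W′| , C) → noCycle (L , ≤-trans L≤|W′| (<⇒≤ |W′|<|W|) , C)
      (no noRepeat) → noCycle (length W , ≤-refl , cycleOfWalk ncw noRepeat)

  NoNegativeCycleShorterThan : ℕ → Set (c ⊔ ℓ ⊔ p)
  NoNegativeCycleShorterThan n = ∀ L → L < n → (C : Cycle L) → ¬ Negative C

  negativeClosedWalk-length : ∀ {n W} → NoNegativeCycleShorterThan n → NegativeClosedWalk W → n ≤ length W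
  negativeClosedWalk-length noShort ncw = ≮⇒≥ λ |W|<n →
    negativeClosedWalk⇒negativeCycle ncw λ (L , L≤|W| , C , negC) → noShort L (≤-<-trans L≤|W| |W|<n) C negC

  record Arcs (X Y : List Step) : Set (c ⊔ ℓ ⊔ p) where
    field
      admissibleˡ : All Admissible X
      admissibleʳ : All Admissible Y
      sameEnds    : ∑ X ≈ ∑ Y
      negative    : ∏ X · ∏ Y ≡ neg

  Arcs-sym : ∀ {X Y} → Arcs X Y → Arcs Y X
  Arcs-sym {X} {Y} arcs = record
    { admissibleˡ = admissibleʳ
    ; admissibleʳ = admissibleˡ
    ; sameEnds    = sym sameEnds
    ; negative    = ≡.trans (·-comm (∏ Y) (∏ X)) negative
    }
    where open Arcs arcs

  -- Otherwise Z ++ Y would be a negative closed walk shorter than n.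
  arc-shortest : ∀ {n X Y Z} → NoNegativeCycleShorterThan n → Arcs X Y → length X + length Y ≡ n →
                 All Admissible Z → ∑ Z ≈ ∑ X → ∏ Z ≡ ∏ X → length X ≤ length Z
  arc-shortest {n} {X} {Y} {Z} noShort arcs |X|+|Y|≡n admZ ∑Z≈∑X ∏Z≡∏X =
    +-cancelʳ-≤ (length Y) (length X) (length Z)
      (subst₂ _≤_ (≡.sym |X|+|Y|≡n) (length-++ Z) (negativeClosedWalk-length noShort ZY))
    where
    open Arcs arcs
    ZY : NegativeClosedWalk (Z ++ Y)
    ZY = record
      { admissible = ++⁺ admZ admissibleʳ
      ; closed     = trans (∑-++ Z Y) (≈⇒∙≈ε (trans ∑Z≈∑X sameEnds))
      ; negative   = ≡.trans (∏-++ Z Y) (≡.trans (cong (_· ∏ Y) ∏Z≡∏X) negative)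
      }

  select-⊕-∑ : ∀ {m} (u v : Vec Bool m) (f : Fin m → Step) →
                 ∑ (select u f) ∙ ∑ (select v f) ≈ ∑ (select (u ⊕ v) f)
  select-⊕-∑ []          []          f = identityˡ ε
  select-⊕-∑ (true  ∷ u) (true  ∷ v) f = trans (xy∙xz≈yz _ _ _) (select-⊕-∑ u v (f ∘ fsuc))
  select-⊕-∑ (true  ∷ u) (false ∷ v) f =
    trans (assoc _ _ _) (∙-congˡ (select-⊕-∑ u v (f ∘ fsuc)))
  select-⊕-∑ (false ∷ u) (true  ∷ v) f =
    trans (x∙yz≈y∙xz _ _ _) (∙-congˡ (select-⊕-∑ u v (f ∘ fsuc)))
  select-⊕-∑ (false ∷ u) (false ∷ v) f = select-⊕-∑ u v (f ∘ fsuc)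

  select-⊕-∏ : ∀ {m} (u v : Vec Bool m) (f : Fin m → Step) →
                 ∏ (select u f) · ∏ (select v f) ≡ ∏ (select (u ⊕ v) f)
  select-⊕-∏ []          []          f = refl
  select-⊕-∏ (true  ∷ u) (true  ∷ v) f =
    ≡.trans (xy·xz≡yz (proj₂ (f fzero)) _ _) (select-⊕-∏ u v (f ∘ fsuc))
  select-⊕-∏ (true  ∷ u) (false ∷ v) f =
    ≡.trans (·-assoc (proj₂ (f fzero)) _ _) (cong (proj₂ (f fzero) ·_) (select-⊕-∏ u v (f ∘ fsuc)))
  select-⊕-∏ (false ∷ u) (true  ∷ v) f =
    ≡.trans (x·yz≡y·xz (∏ (select u (f ∘ fsuc))) (proj₂ (f fzero)) _)
            (cong (proj₂ (f fzero) ·_) (select-⊕-∏ u v (f ∘ fsuc)))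
  select-⊕-∏ (false ∷ u) (false ∷ v) f = select-⊕-∏ u v (f ∘ fsuc)

  select-reject-∑ : ∀ {m} (w : Vec Bool m) (f : Fin m → Step) →
                    ∑ (select w f) ∙ ∑ (reject w f) ≈ sum (proj₁ ∘ f)
  select-reject-∑ []          f = identityˡ ε
  select-reject-∑ (true  ∷ w) f = trans (assoc _ _ _) (∙-congˡ (select-reject-∑ w (f ∘ fsuc)))
  select-reject-∑ (false ∷ w) f = trans (x∙yz≈y∙xz _ _ _) (∙-congˡ (select-reject-∑ w (f ∘ fsuc)))

  select-reject-∏ : ∀ {m} (w : Vec Bool m) (f : Fin m → Step) →
                    ∏ (select w f) · ∏ (reject w f) ≡ prod (proj₂ ∘ f)
  select-reject-∏ []          f = refl
  select-reject-∏ (true  ∷ w) f =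
    ≡.trans (·-assoc (proj₂ (f fzero)) _ _) (cong (proj₂ (f fzero) ·_) (select-reject-∏ w (f ∘ fsuc)))
  select-reject-∏ (false ∷ w) f =
    ≡.trans (x·yz≡y·xz (∏ (select w (f ∘ fsuc))) (proj₂ (f fzero)) _)
            (cong (proj₂ (f fzero) ·_) (select-reject-∏ w (f ∘ fsuc)))

  sum-∘cyc : ∀ {n} (v : Fin (suc n) → Carrier) → sum (v ∘ cyc) ≈ sum v
  sum-∘cyc {n} v = begin
    sum (v ∘ cyc)                                ≈⟨ sum-init-last (v ∘ cyc) ⟩
    sum (λ i → v (cyc (inject₁ i))) ∙ v (cyc (fromℕ n))
      ≡⟨ cong₂ _∙_ (sum-cong-≗ (λ i → cong v (cyc-inject₁ i))) (cong v (cyc-fromℕ n)) ⟩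
    sum (v ∘ fsuc) ∙ v fzero                     ≈⟨ comm _ _ ⟩
    sum v                                        ∎

  sum-around-cycle : ∀ {n} (v : Fin (suc n) → Carrier) → sum (λ i → v i ∙ v (cyc i) ⁻¹) ≈ ε
  sum-around-cycle v = begin
    sum (λ i → v i ∙ v (cyc i) ⁻¹)        ≈⟨ ∑-distrib-+ v (λ i → v (cyc i) ⁻¹) ⟩
    sum v ∙ sum (λ i → v (cyc i) ⁻¹)      ≈⟨ ∙-congˡ (sum-cong-≋ (λ i → x⁻¹≈x (v (cyc i)))) ⟩
    sum v ∙ sum (v ∘ cyc)                 ≈⟨ ∙-congˡ (sum-∘cyc v) ⟩
    sum v ∙ sum v                         ≈⟨ binary (sum v) ⟩
    ε                                     ∎

  no-loop : Bipartite → ∀ s → ¬ Conn s ε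
  no-loop (_ , _ , proper) s conn =
    proper ε ε s (Conn-resp s (sym (inverseʳ ε)) conn) refl

  ∑≉ε⇒nonempty : ∀ W → ¬ ∑ W ≈ ε → 1 ≤ length W
  ∑≉ε⇒nonempty []      ∑≉ε = ⊥-elim (∑≉ε ≈-refl)
  ∑≉ε⇒nonempty (_ ∷ _) _   = s≤s z≤n

  -- Edge 0 of C is the closing edge; edges 1, …, m are the generators of SPC(m).
  module Embedding (bipartite : Bipartite) {m} (C : Cycle (suc m)) (negC : Negative C)
                   (noShort : NoNegativeCycleShorterThan (suc m)) where
    open Cycle C using (vert; sgn; edge)

    step : Fin (suc m) → Step
    step i = vert i ∙ vert (cyc i) ⁻¹ , sgn i

    generator : Fin m → Step
    generator = step ∘ fsuc

    arcˡ arcʳ : Vec Bool m → List Step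
    arcˡ w = select w generator
    arcʳ w = step fzero ∷ reject w generator

    arcs : ∀ w → Arcs (arcˡ w) (arcʳ w)
    arcs w = record
      { admissibleˡ = select⁺ w (edge ∘ fsuc)
      ; admissibleʳ = edge fzero ∷ reject⁺ w (edge ∘ fsuc)
      ; sameEnds    = ∙≈ε⇒≈ (trans (select-reject-∑ (false ∷ w) step) (sum-around-cycle vert))
      ; negative    = ≡.trans (select-reject-∏ (false ∷ w) step) negC
      }

    length-arcs : ∀ w → length (arcˡ w) + length (arcʳ w) ≡ suc m
    length-arcs w = length-select+reject (false ∷ w) step

    φ : Vec Bool m → Carrier
    φ w = ∑ (arcˡ w)

    τ : Vec Bool m → Sign
    τ w = ∏ (arcˡ w)

    arcˡ-shortest : ∀ w {Z} → All Admissible Z → ∑ Z ≈ φ w → ∏ Z ≡ τ w → length (arcˡ w) ≤ length Z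
    arcˡ-shortest w = arc-shortest noShort (arcs w) (length-arcs w)

    arcʳ-shortest : ∀ w {Z} → All Admissible Z → ∑ Z ≈ φ w → ∏ Z ≡ ∏ (arcʳ w) →
                    length (arcʳ w) ≤ length Z
    arcʳ-shortest w admZ ∑Z≈φw = arc-shortest noShort (Arcs-sym (arcs w))
      (≡.trans (+-comm (length (arcʳ w)) (length (arcˡ w))) (length-arcs w))
      admZ (trans ∑Z≈φw (Arcs.sameEnds (arcs w)))

    φ-∙ : ∀ u v → φ u ∙ φ v ⁻¹ ≈ φ (u ⊕ v)
    φ-∙ u v = trans (∙-congˡ (x⁻¹≈x (φ v))) (select-⊕-∑ u v generator)

    τ-· : ∀ u v → τ u · τ v ≡ τ (u ⊕ v)
    τ-· u v = select-⊕-∏ u v generator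

    -- An edge φ w of sign s is a walk of length 1, so it is at least as long as the arc
    -- of sign s: either arcˡ w is a single generator or arcʳ w is the closing edge alone.
    classify-edge : ∀ w s → Conn s (φ w) →
                    (τ w · s ≡ pos × ∃ λ i → w ≡ basis i) ⊎ (τ w · s ≡ neg × w ≡ allOnes)
    classify-edge w s conn with either-sign (Arcs.negative (arcs w)) s
    ... | inj₁ s≡τw = inj₁ (≡.trans (cong (τ w ·_) s≡τw) (s·s≡pos (τ w)) ,
                            select-singleton w generator (≤-antisym |arcˡ|≤1 1≤|arcˡ|))
      where
      |arcˡ|≤1 : length (arcˡ w) ≤ 1
      |arcˡ|≤1 = arcˡ-shortest w (conn ∷ []) (identityʳ (φ w)) (≡.trans (·-identityʳ s) s≡τw)
      1≤|arcˡ| : 1 ≤ length (arcˡ w)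
      1≤|arcˡ| = ∑≉ε⇒nonempty (arcˡ w) λ φw≈ε → no-loop bipartite s (Conn-resp s φw≈ε conn)
    ... | inj₂ s≡∏arcʳ = inj₂ (≡.trans (cong (τ w ·_) s≡∏arcʳ) (Arcs.negative (arcs w)) ,
                               reject-empty w generator (n≤0⇒n≡0 (≤-pred |arcʳ|≤1)))
      where
      |arcʳ|≤1 : length (arcʳ w) ≤ 1
      |arcʳ|≤1 = arcʳ-shortest w (conn ∷ []) (identityʳ (φ w)) (≡.trans (·-identityʳ s) s≡∏arcʳ)

    generator-edge : ∀ i s → τ (basis i) · s ≡ pos → Conn s (φ (basis i))
    generator-edge i s τs≡pos rewrite select-basis i generator =
      subst (λ t → Conn t (φᵢ ∙ ε)) σᵢ≡s (Conn-resp σᵢ (sym (identityʳ φᵢ)) (edge (fsuc i)))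
      where
      φᵢ = proj₁ (generator i)
      σᵢ = proj₂ (generator i)
      σᵢ≡s : σᵢ ≡ s
      σᵢ≡s = ·≡pos⇒≡ σᵢ (≡.trans (cong (_· s) (≡.sym (·-identityʳ σᵢ))) τs≡pos)

    closing-edge : ∀ s → τ allOnes · s ≡ neg → Conn s (φ allOnes)
    closing-edge s τs≡neg =
      subst (λ t → Conn t (φ allOnes)) σ₀≡s (Conn-resp σ₀ φ₀≈φ (edge fzero))
      where
      open Arcs (arcs allOnes)
      φ₀ = proj₁ (step fzero)
      σ₀ = proj₂ (step fzero)
      arcʳ≡ : arcʳ allOnes ≡ step fzero ∷ []
      arcʳ≡ = cong (step fzero ∷_) (reject-allOnes m generator)
      φ₀≈φ : φ₀ ≈ φ allOnes
      φ₀≈φ = sym (trans sameEnds (trans (reflexive (cong ∑ arcʳ≡)) (identityʳ φ₀)))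
      σ₀≡s : σ₀ ≡ s
      σ₀≡s = ·-cancelˡ-≡ (τ allOnes)
        (≡.trans (≡.trans (cong (τ allOnes ·_) (≡.sym (·-identityʳ σ₀)))
                   (≡.trans (cong (λ Y → τ allOnes · ∏ Y) (≡.sym arcʳ≡)) negative))
                 (≡.sym τs≡neg))

    φ-injective : ∀ u v → φ u ≈ φ v → u ≡ v
    φ-injective u v φu≈φv = ⊕≡0⇒≡ u v (select-empty w generator (n≤0⇒n≡0 |arcˡ|≤0))
      where
      w = u ⊕ v
      ε≈φw : ε ≈ φ w
      ε≈φw = trans (sym (≈⇒∙≈ε φu≈φv)) (select-⊕-∑ u v generator)
      |arcˡ|≤0 : length (arcˡ w) ≤ 0
      |arcˡ|≤0 with either-sign (Arcs.negative (arcs w)) pos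
      ... | inj₁ pos≡τw   = arcˡ-shortest w [] ε≈φw pos≡τw
      ... | inj₂ pos≡∏arcʳ with arcʳ-shortest w [] ε≈φw pos≡∏arcʳ
      ...   | ()

    forward : ∀ u v s → Edge (φ u) (φ v) s → SPCEdge m u v ((τ u · τ v) · s)
    forward u v s e rewrite τ-· u v with classify-edge (u ⊕ v) s (Conn-resp s (φ-∙ u v) e)
    ... | inj₁ (τs≡pos , generator≡) rewrite τs≡pos = generator≡
    ... | inj₂ (τs≡neg , allOnes≡)  rewrite τs≡neg = allOnes≡

    backward : ∀ u v s → SPCEdge m u v ((τ u · τ v) · s) → Edge (φ u) (φ v) s
    backward u v s spc rewrite τ-· u v with τ (u ⊕ v) · s in τs≡
    ... | pos = let i , w≡eᵢ = spc in Conn-resp s (sym (φ-∙ u v))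
      (subst (λ w → τ w · s ≡ pos → Conn s (φ w)) (≡.sym w≡eᵢ) (generator-edge i s) τs≡)
    ... | neg = Conn-resp s (sym (φ-∙ u v))
      (subst (λ w → τ w · s ≡ neg → Conn s (φ w)) (≡.sym spc) (closing-edge s) τs≡)

    containsInducedSPC : ContainsInducedSPC Γ S⁺ S⁻ m
    containsInducedSPC = φ , φ-injective , τ , λ u v s → mk⇔ (forward u v s) (backward u v s)

unbalancedGirth⇒inducedSPC : ∀ {c ℓ p} (Γ : AbelianGroup c ℓ) → IsBinary Γ →
  (S⁺ S⁻ : Pred (AbelianGroup.Carrier Γ) p) →
  S⁺ Respects (AbelianGroup._≈_ Γ) → S⁻ Respects (AbelianGroup._≈_ Γ) →
  (m : ℕ) →
  SignedCayley.Bipartite Γ S⁺ S⁻ →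
  SignedCayley.UnbalancedGirth Γ S⁺ S⁻ (suc m) →
  ContainsInducedSPC Γ S⁺ S⁻ m
unbalancedGirth⇒inducedSPC Γ binary S⁺ S⁻ S⁺-resp S⁻-resp m bipartite ((C , negC) , noShort) =
  Embedding.containsInducedSPC bipartite C negC noShort
  where open SignedCayleyWalks Γ binary S⁺ S⁻ S⁺-resp S⁻-resp

mainTheorem4 : ∀ {c ℓ p} (Γ : AbelianGroup c ℓ) → IsBinary Γ →
    (S⁺ S⁻ : Pred (AbelianGroup.Carrier Γ) p) →
    S⁺ Respects (AbelianGroup._≈_ Γ) → S⁻ Respects (AbelianGroup._≈_ Γ) →
    (k : ℕ) →
    SignedCayley.Bipartite Γ S⁺ S⁻ →
    SignedCayley.UnbalancedGirth Γ S⁺ S⁻ (2 * k) →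
    ContainsInducedSPC Γ S⁺ S⁻ (2 * k ∸ 1)
mainTheorem4 Γ binary S⁺ S⁻ S⁺-resp S⁻-resp zero _ ((C , _) , _) with SignedCayley.Cycle.nonempty C
... | ()
mainTheorem4 Γ binary S⁺ S⁻ S⁺-resp S⁻-resp (suc k) =
  unbalancedGirth⇒inducedSPC Γ binary S⁺ S⁻ S⁺-resp S⁻-resp (2 * suc k ∸ 1)
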